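{- Let $n \geq 5$ be an integer. Then the generalized Petersen graph $GP(n,2)$ is $1$-distance-balanced if and only if $n \in \{5,7,10\}$.
   Context: The generalized Petersen graph $GP(n,k)$ has vertex set $\{u_i \mid i \in \mathbb{Z}_n\} \cup \{v_i \mid i \in \mathbb{Z}_n\}$ and edges $u_iu_{i+1}$, $v_iv_{i+k}$, $u_iv_i$ for $i \in \mathbb{Z}_n$. For vertices $u,v$, $W_{uv} = \{w \mid d(u,w) < d(v,w)\}$. A connected graph is $1$-distance-balanced if $|W_{uv}| = |W_{vu}|$ for every pair of adjacent vertices $u,v$. -}

module Defs where

open import Data.Nat using (ℕ; zero; suc; _+_; _*_; _<_; _≤_; NonZero)
open import Data.Nat.DivMod using (_%_)
open import Data.Fin using (Fin; toℕ)
open import Data.Fin.Properties using (_≟_)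
open import Data.Bool using (Bool; true; false; _∨_; _∧_; if_then_else_)
open import Data.List using (List; map; _++_; length; filter; allFin)
open import Data.Bool.ListAction using (any)
open import Data.Sum using (_⊎_; inj₁; inj₂)
open import Data.Product using (_×_; _,_)
open import Relation.Nullary.Decidable using (⌊_⌋; does)
open import Relation.Binary.PropositionalEquality using (_≡_)
import Data.Nat as ℕ

-- Generalized Petersen graph GP(n,k).
-- Vertices: inj₁ i = u_i (outer), inj₂ i = v_i (inner), i ∈ ℤ_n = Fin n.
-- Edges: u_i u_{i+1}, v_i v_{i+k}, u_i v_i (indices mod n).

Vertex : ℕ → Set
Vertex n = Fin n ⊎ Fin n

_≡ₙ_ : {n : ℕ} → Fin n → ℕ → Bool
_≡ₙ_ {zero} ()
_≡ₙ_ {suc n} i m = ⌊ toℕ i ℕ.≟ (m % suc n) ⌋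

adj : (n k : ℕ) → Vertex n → Vertex n → Bool
adj n k (inj₁ i) (inj₁ j) = (j ≡ₙ (toℕ i + 1)) ∨ (i ≡ₙ (toℕ j + 1))
adj n k (inj₂ i) (inj₂ j) = (j ≡ₙ (toℕ i + k)) ∨ (i ≡ₙ (toℕ j + k))
adj n k (inj₁ i) (inj₂ j) = ⌊ i ≟ j ⌋
adj n k (inj₂ i) (inj₁ j) = ⌊ i ≟ j ⌋

_≟V_ : {n : ℕ} → Vertex n → Vertex n → Bool
inj₁ i ≟V inj₁ j = ⌊ i ≟ j ⌋
inj₂ i ≟V inj₂ j = ⌊ i ≟ j ⌋
inj₁ _ ≟V inj₂ _ = false
inj₂ _ ≟V inj₁ _ = false

vertices : (n : ℕ) → List (Vertex n)
vertices n = map inj₁ (allFin n) ++ map inj₂ (allFin n)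

walk : (n k : ℕ) → ℕ → Vertex n → Vertex n → Bool
walk n k zero    x y = x ≟V y
walk n k (suc ℓ) x y =
  walk n k ℓ x y ∨ any (λ z → adj n k x z ∧ walk n k ℓ z y) (vertices n)

-- Graph distance: least ℓ with a walk of length ≤ ℓ from x to y, searched
-- up to bound b; returns b if none (only relevant for disconnected graphs;
-- any walk-connected pair in a graph on 2n vertices has distance < 2n).
distFrom : (n k : ℕ) → ℕ → ℕ → Vertex n → Vertex n → ℕ
distFrom n k ℓ zero    x y = ℓ
distFrom n k ℓ (suc b) x y =
  if walk n k ℓ x y then ℓ else distFrom n k (suc ℓ) b x y

dist : (n k : ℕ) → Vertex n → Vertex n → ℕ
dist n k x y = distFrom n k 0 (2 * n) x y

W : (n k : ℕ) → Vertex n → Vertex n → List (Vertex n)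
W n k x y = filter (λ w → dist n k x w ℕ.<? dist n k y w) (vertices n)

Connected : (n k : ℕ) → Set
Connected n k = ∀ (x y : Vertex n) → walk n k (2 * n) x y ≡ true

OneDistanceBalanced : (n k : ℕ) → Set
OneDistanceBalanced n k =
  Connected n k ×
  (∀ (x y : Vertex n) → adj n k x y ≡ true →
     length (W n k x y) ≡ length (W n k y x))

-- For n ≤ 17 both directions are settled by evaluating the definitions. For n ≥ 18 the spoke
-- u₀v₀ is not balanced. A function on the vertices that vanishes at u₀ and grows by at most one
-- along every edge is a lower bound for d(u₀, ·); the distances from u₀ in the infinite graph
-- GP(ℤ,2), taken the shorter way round the cycle, form such a function. Explicit walks from v₀
-- show that v₀ is strictly closer than u₀ to the n − 7 outer vertices u_i with 4 ≤ i ≤ n − 4 and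
-- to the eight inner vertices v_i with i ∈ {0,2,4,6} or n − i ∈ {2,4,6,8}. Hence
-- |W_{v₀u₀}| > n, whereas |W_{u₀v₀}| + |W_{v₀u₀}| ≤ 2n.

module Submission where

open import Defs
open import Data.Bool using (Bool; true; false; _∧_; _∨_; not; T; T?; if_then_else_)
open import Data.Bool.ListAction using (any; all)
open import Data.Bool.Properties using (∨-zeroʳ; T-∧; T-∨)
open import Data.Empty using (⊥-elim)
open import Data.Fin using (Fin; zero; suc; toℕ)
open import Data.Fin.Properties using (toℕ<n; toℕ-fromℕ<; toℕ-injective) renaming (_≟_ to _≟ᶠ_)
open import Data.List using ([]; _∷_; map; _++_; length; filter; allFin; tabulate)
open import Data.List.Membership.Propositional using (_∈_)
open import Data.List.Membership.Propositional.Properties using (∈-map⁺; ∈-++⁺ˡ; ∈-++⁺ʳ; ∈-allFin)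
open import Data.List.Properties using (filter-++; length-++; length-map; length-tabulate; map-tabulate)
open import Data.List.Relation.Unary.Any using (here; there)
import Data.List.Relation.Binary.Sublist.Propositional as Sublist
import Data.List.Relation.Binary.Sublist.Propositional.Properties as Sublist
open import Data.Nat
open import Data.Nat.DivMod using (_%_; _mod_; m<n⇒m%n≡m; [m+n]%n≡m%n; n%n≡0; m%n<n; %-distribˡ-+; m%n%n≡m%n)
open import Data.Nat.Properties
open import Data.Product using (_×_; _,_; proj₁; proj₂; uncurry; ∃-syntax)
open import Data.Sum using (_⊎_; inj₁; inj₂)
open import Function.Base using (_∘_; id)
open import Function.Bundles using (_⇔_; mk⇔; module Equivalence)
open import Level using (0ℓ)
open import Relation.Binary.PropositionalEquality
open import Relation.Nullary using (Dec; yes; no; ¬_; does)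
open import Relation.Nullary.Decidable using (⌊_⌋)
open import Relation.Unary using (Pred; Decidable)

∨-true⁻ : ∀ {a b} → a ∨ b ≡ true → a ≡ true ⊎ b ≡ true
∨-true⁻ {true}  _ = inj₁ refl
∨-true⁻ {false} e = inj₂ e

∨-introˡ : ∀ {a b} → a ≡ true → a ∨ b ≡ true
∨-introˡ refl = refl

∨-introʳ : ∀ {a b} → b ≡ true → a ∨ b ≡ true
∨-introʳ {a} refl = ∨-zeroʳ a

∧-true⁻ : ∀ {a b} → a ∧ b ≡ true → a ≡ true × b ≡ true
∧-true⁻ {true} {true} _ = refl , refl

⌊⌋-true⁻ : ∀ {A : Set} (a? : Dec A) → ⌊ a? ⌋ ≡ true → A
⌊⌋-true⁻ (yes a) _ = a

⌊⌋-true⁺ : ∀ {A : Set} (a? : Dec A) → A → ⌊ a? ⌋ ≡ true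
⌊⌋-true⁺ (yes _) _ = refl
⌊⌋-true⁺ (no ¬a) a = ⊥-elim (¬a a)

any-true⁺ : ∀ {A : Set} (p : A → Bool) {xs x} → x ∈ xs → p x ≡ true → any p xs ≡ true
any-true⁺ p {y ∷ _}  (here refl) e rewrite e = refl
any-true⁺ p {y ∷ ys} (there x∈) e with p y
... | true  = refl
... | false = any-true⁺ p x∈ e

any-true⁻ : ∀ {A : Set} (p : A → Bool) xs → any p xs ≡ true → ∃[ x ] p x ≡ true
any-true⁻ p (y ∷ ys) e with p y in eq
... | true  = y , eq
... | false = any-true⁻ p ys e

all-true⁻ : ∀ {A : Set} (p : A → Bool) {xs x} → all p xs ≡ true → x ∈ xs → p x ≡ true
all-true⁻ p {y ∷ _} e (here refl) = proj₁ (∧-true⁻ e)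
all-true⁻ p {y ∷ _} e (there x∈) = all-true⁻ p (proj₂ (∧-true⁻ {p y} e)) x∈

length-filter-mono : ∀ {A : Set} {P Q : Pred A 0ℓ} (P? : Decidable P) (Q? : Decidable Q) →
                     (∀ {x} → P x → Q x) → ∀ xs → length (filter P? xs) ≤ length (filter Q? xs)
length-filter-mono P? Q? P⇒Q xs =
  Sublist.length-mono-≤ (Sublist.filter⁺ P? Q? (λ { refl → P⇒Q }) (Sublist.⊆-refl {x = xs}))

length-filter-disjoint : ∀ {A : Set} {P Q : Pred A 0ℓ} (P? : Decidable P) (Q? : Decidable Q) →
                         (∀ {x} → P x → ¬ Q x) →
                         ∀ xs → length (filter P? xs) + length (filter Q? xs) ≤ length xs
length-filter-disjoint P? Q? disjoint [] = z≤n
length-filter-disjoint P? Q? disjoint (x ∷ xs) with P? x | Q? x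
... | yes p | yes q = ⊥-elim (disjoint p q)
... | yes _ | no _  = s≤s (length-filter-disjoint P? Q? disjoint xs)
... | no _  | yes _ = ≤-trans (≤-reflexive (+-suc _ _)) (s≤s (length-filter-disjoint P? Q? disjoint xs))
... | no _  | no _  = m≤n⇒m≤1+n (length-filter-disjoint P? Q? disjoint xs)

count : (ℕ → Bool) → ℕ → ℕ
count p zero    = 0
count p (suc m) = (if p 0 then 1 else 0) + count (λ j → p (suc j)) m

count-+ : ∀ p a b → count p (a + b) ≡ count p a + count (λ j → p (a + j)) b
count-+ p zero    b = refl
count-+ p (suc a) b = trans (cong (p₀ +_) (count-+ (λ j → p (suc j)) a b)) (sym (+-assoc p₀ _ _))
  where p₀ = if p 0 then 1 else 0

count-≤ˡ : ∀ p a b → count p a ≤ count p (a + b)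
count-≤ˡ p a b = ≤-trans (m≤m+n _ _) (≤-reflexive (sym (count-+ p a b)))

count-≤ʳ : ∀ p a b → count (λ j → p (a + j)) b ≤ count p (a + b)
count-≤ʳ p a b = ≤-trans (m≤n+m _ _) (≤-reflexive (sym (count-+ p a b)))

count-mono : ∀ {p q} m → (∀ j → j < m → T (p j) → T (q j)) → count p m ≤ count q m
count-mono zero p⇒q = z≤n
count-mono {p} {q} (suc m) p⇒q with p 0 in p₀ | q 0 in q₀
... | true  | false with () ← subst T q₀ (p⇒q 0 z<s (subst T (sym p₀) _))
... | true  | true  = s≤s (count-mono m (λ j j<m → p⇒q (suc j) (s≤s j<m)))
... | false | true  = m≤n⇒m≤1+n (count-mono m (λ j j<m → p⇒q (suc j) (s≤s j<m)))
... | false | false = count-mono m (λ j j<m → p⇒q (suc j) (s≤s j<m))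

count-all : ∀ {p} m → (∀ j → j < m → T (p j)) → count p m ≡ m
count-all zero all-p = refl
count-all {p} (suc m) all-p with p 0 | all-p 0 z<s
... | true | _ = cong suc (count-all m (λ j j<m → all-p (suc j) (s≤s j<m)))

length-filter-tabulate : ∀ {A : Set} {P : Pred A 0ℓ} (P? : Decidable P) {m} (g : Fin m → A) (p : ℕ → Bool) →
                         (∀ i → does (P? (g i)) ≡ p (toℕ i)) → length (filter P? (tabulate g)) ≡ count p m
length-filter-tabulate P? {zero}  g p agree = refl
length-filter-tabulate P? {suc m} g p agree with p 0 | does (P? (g zero)) | agree zero
... | true  | true  | refl = cong suc (length-filter-tabulate P? (g ∘ suc) (λ j → p (suc j)) (agree ∘ suc))
... | false | false | refl = length-filter-tabulate P? (g ∘ suc) (λ j → p (suc j)) (agree ∘ suc)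

∈-vertices : ∀ {n} (x : Vertex n) → x ∈ vertices n
∈-vertices (inj₁ i) = ∈-++⁺ˡ (∈-map⁺ inj₁ (∈-allFin i))
∈-vertices {n} (inj₂ i) = ∈-++⁺ʳ (map inj₁ (allFin n)) (∈-map⁺ inj₂ (∈-allFin i))

length-vertices : ∀ n → length (vertices n) ≡ n + n
length-vertices n = trans (length-++ (map inj₁ (allFin n))) (cong₂ _+_ (length-side inj₁) (length-side inj₂))
  where
  length-side : (g : Fin n → Vertex n) → length (map g (allFin n)) ≡ n
  length-side g = trans (length-map g (allFin n)) (length-tabulate id)

≟V-sound : ∀ {n} {x y : Vertex n} → x ≟V y ≡ true → x ≡ y
≟V-sound {x = inj₁ i} {inj₁ j} e = cong inj₁ (⌊⌋-true⁻ (i ≟ᶠ j) e)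
≟V-sound {x = inj₂ i} {inj₂ j} e = cong inj₂ (⌊⌋-true⁻ (i ≟ᶠ j) e)

≟V-refl : ∀ {n} (x : Vertex n) → x ≟V x ≡ true
≟V-refl (inj₁ i) = ⌊⌋-true⁺ (i ≟ᶠ i) refl
≟V-refl (inj₂ i) = ⌊⌋-true⁺ (i ≟ᶠ i) refl

module Walks (n k : ℕ) where

  -- A record rather than the bare Boolean equation, so that the endpoints of an edge, and
  -- hence the intermediate vertices of a path, can be inferred.
  record Edge (x y : Vertex n) : Set where
    constructor edge
    field adjacent : adj n k x y ≡ true

  data Path : ℕ → Vertex n → Vertex n → Set where
    []  : ∀ {x} → Path 0 x x
    _∷_ : ∀ {ℓ x z y} → Edge x z → Path ℓ z y → Path (suc ℓ) x y

  path⇒walk : ∀ {ℓ x y} → Path ℓ x y → walk n k ℓ x y ≡ true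
  path⇒walk {x = x} [] = ≟V-refl x
  path⇒walk {suc ℓ} {x} {y} (_∷_ {z = z} (edge e) p) with walk n k ℓ x y
  ... | true  = refl
  ... | false = any-true⁺ (λ z → adj n k x z ∧ walk n k ℓ z y) (∈-vertices z) (cong₂ _∧_ e (path⇒walk p))

  walk-potential : (φ : Vertex n → ℕ) → (∀ {x z} → Edge x z → φ z ≤ suc (φ x)) →
                   ∀ ℓ {x y} → walk n k ℓ x y ≡ true → φ y ≤ φ x + ℓ
  walk-potential φ step zero {x} w = subst (λ y → φ y ≤ φ x + 0) (≟V-sound w) (m≤m+n (φ x) 0)
  walk-potential φ step (suc ℓ) {x} {y} w with ∨-true⁻ {walk n k ℓ x y} w
  ... | inj₁ w′ = ≤-trans (walk-potential φ step ℓ w′) (+-monoʳ-≤ (φ x) (n≤1+n ℓ))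
  ... | inj₂ w′ with any-true⁻ _ (vertices n) w′
  ... | z , xz with ∧-true⁻ {adj n k x z} xz
  ... | a , w″ = begin
    φ y            ≤⟨ walk-potential φ step ℓ w″ ⟩
    φ z + ℓ        ≤⟨ +-monoˡ-≤ ℓ (step (edge a)) ⟩
    suc (φ x) + ℓ  ≡⟨ +-suc (φ x) ℓ ⟨
    φ x + suc ℓ    ∎
    where open ≤-Reasoning

  distFrom-≤ : ∀ {ℓ x y} b ℓ₀ → walk n k ℓ x y ≡ true → ℓ₀ ≤ ℓ → ℓ < ℓ₀ + b →
               distFrom n k ℓ₀ b x y ≤ ℓ
  distFrom-≤ zero ℓ₀ w ℓ₀≤ℓ ℓ<ℓ₀+0 = ⊥-elim (<⇒≱ (subst (_ <_) (+-identityʳ ℓ₀) ℓ<ℓ₀+0) ℓ₀≤ℓ)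
  distFrom-≤ {ℓ} {x} {y} (suc b) ℓ₀ w ℓ₀≤ℓ ℓ<ℓ₀+b with walk n k ℓ₀ x y in eq
  ... | true  = ℓ₀≤ℓ
  ... | false with m≤n⇒m<n∨m≡n ℓ₀≤ℓ
  ... | inj₁ ℓ₀<ℓ = distFrom-≤ b (suc ℓ₀) w ℓ₀<ℓ (≤-trans ℓ<ℓ₀+b (≤-reflexive (+-suc ℓ₀ b)))
  ... | inj₂ refl with () ← trans (sym eq) w

  dist-≤ : ∀ {ℓ x y} → Path ℓ x y → ℓ < 2 * n → dist n k x y ≤ ℓ
  dist-≤ p ℓ<2n = distFrom-≤ (2 * n) 0 (path⇒walk p) z≤n ℓ<2n

  distFrom-found : ∀ {x y} b ℓ₀ →
                   distFrom n k ℓ₀ b x y ≡ ℓ₀ + b ⊎ walk n k (distFrom n k ℓ₀ b x y) x y ≡ true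
  distFrom-found zero ℓ₀ = inj₁ (sym (+-identityʳ ℓ₀))
  distFrom-found {x} {y} (suc b) ℓ₀ with walk n k ℓ₀ x y in eq
  ... | true  = inj₂ eq
  ... | false with distFrom-found b (suc ℓ₀)
  ... | inj₁ e = inj₁ (trans e (sym (+-suc ℓ₀ b)))
  ... | inj₂ w = inj₂ w

  -- dist returns the search bound 2n when it finds no walk, hence the hypothesis G ≤ 2 * n.
  ≤-dist : ∀ {x y} G → (∀ ℓ → walk n k ℓ x y ≡ true → G ≤ ℓ) → G ≤ 2 * n → G ≤ dist n k x y
  ≤-dist G below G≤2n with distFrom-found (2 * n) 0
  ... | inj₁ e = ≤-trans G≤2n (≤-reflexive (sym e))
  ... | inj₂ w = below _ w

  potential≤dist : (φ : Vertex n → ℕ) → (∀ {x z} → Edge x z → φ z ≤ suc (φ x)) →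
                   (∀ w → φ w ≤ 2 * n) → ∀ {x} → φ x ≡ 0 → ∀ w → φ w ≤ dist n k x w
  potential≤dist φ step bounded {x} φx≡0 w =
    ≤-dist (φ w) (λ ℓ walk-xw → subst (λ a → φ w ≤ a + ℓ) φx≡0 (walk-potential φ step ℓ walk-xw))
           (bounded w)

Close : ℕ → ℕ → Set
Close a b = a ≤ suc b × b ≤ suc a

Close-sym : ∀ {a b} → Close a b → Close b a
Close-sym (a≤ , b≤) = b≤ , a≤

Close-⊓ : ∀ {a a′ b b′} → Close a a′ → Close b b′ → Close (a ⊓ b) (a′ ⊓ b′)
Close-⊓ (a≤ , a′≤) (b≤ , b′≤) = ⊓-mono-≤ a≤ b≤ , ⊓-mono-≤ a′≤ b′≤

Close-within : ∀ {lo a b} → lo ≤ a → a ≤ suc lo → lo ≤ b → b ≤ suc lo → Close a b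
Close-within lo≤a a≤ lo≤b b≤ = ≤-trans a≤ (s≤s lo≤b) , ≤-trans b≤ (s≤s lo≤a)

⌈n/2⌉-step : ∀ m → Close ⌈ m /2⌉ ⌈ suc m /2⌉
⌈n/2⌉-step m = ≤-trans (⌊n/2⌋-mono (n≤1+n (suc m))) (n≤1+n _) , s≤s (⌊n/2⌋≤⌈n/2⌉ m)

-- The distances from u₀ to u_m and to v_m in GP(ℤ,2), for m ≥ 0: u_m is reached along the
-- outer cycle or via two spokes and about m/2 inner edges.
hu hv : ℕ → ℕ
hu m = m ⊓ (2 + ⌈ m /2⌉)
hv m = suc ⌈ m /2⌉

hu-mono : ∀ {a b} → a ≤ b → hu a ≤ hu b
hu-mono a≤b = ⊓-mono-≤ a≤b (+-monoʳ-≤ 2 (⌈n/2⌉-mono a≤b))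

hv-mono : ∀ {a b} → a ≤ b → hv a ≤ hv b
hv-mono a≤b = s≤s (⌈n/2⌉-mono a≤b)

hu-step : ∀ m → Close (hu m) (hu (1 + m))
hu-step m with ⌈n/2⌉-step m
... | ⌈m/2⌉≤ , ⌈1+m/2⌉≤ = Close-⊓ (m≤n⇒m≤1+n (n≤1+n m) , ≤-refl) (s≤s (s≤s ⌈m/2⌉≤) , s≤s (s≤s ⌈1+m/2⌉≤))

hv-step : ∀ m → Close (hv m) (hv (2 + m))
hv-step m = m≤n⇒m≤1+n (n≤1+n (hv m)) , ≤-refl

hu-hv : ∀ m → Close (hu m) (hv m)
hu-hv m = m⊓n≤n m _ , s≤s (⊓-glb (⌈n/2⌉≤n m) (m≤n+m _ 2))

hv<hu : ∀ {m} → 4 ≤ m → hv m < hu m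
hv<hu (s≤s (s≤s (s≤s (s≤s (z≤n {m}))))) = ⊓-glb (+-monoʳ-≤ 4 (⌈n/2⌉≤n m)) ≤-refl

<hv : ∀ {q m} → q + q ≤ suc m → q < hv m
<hv {q} q+q≤ = s≤s (≤-trans (≤-reflexive (n≡⌊n+n/2⌋ q)) (⌊n/2⌋-mono q+q≤))

module Reflection (n : ℕ) .{{_ : NonZero n}} where

  Φ : (ℕ → ℕ) → ℕ → ℕ
  Φ f a = f a ⊓ f (n ∸ a)

  n∸a≡d+[n∸[d+a]] : ∀ {a} d → d + a ≤ n → n ∸ a ≡ d + (n ∸ (d + a))
  n∸a≡d+[n∸[d+a]] {a} d d+a≤n = begin
    n ∸ a                          ≡⟨ cong (_∸ a) (m+[n∸m]≡n d+a≤n) ⟨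
    d + a + (n ∸ (d + a)) ∸ a      ≡⟨ cong (_∸ a) (+-assoc d a _) ⟩
    d + (a + (n ∸ (d + a))) ∸ a    ≡⟨ cong (_∸ a) (+-comm d _) ⟩
    a + (n ∸ (d + a)) + d ∸ a      ≡⟨ cong (_∸ a) (+-assoc a _ d) ⟩
    a + ((n ∸ (d + a)) + d) ∸ a    ≡⟨ m+n∸m≡n a _ ⟩
    (n ∸ (d + a)) + d              ≡⟨ +-comm _ d ⟩
    d + (n ∸ (d + a))              ∎
    where open ≡-Reasoning

  [a+d]%n-cases : ∀ {a c} d → a < n → d ≤ n → c ≡ (a + d) % n → c ≡ d + a ⊎ c + n ≡ a + d
  [a+d]%n-cases {a} {c} d a<n d≤n c≡ with a + d <? n
  ... | yes a+d<n = inj₁ (trans c≡ (trans (m<n⇒m%n≡m a+d<n) (+-comm a d)))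
  ... | no a+d≮n = inj₂ (trans (cong (_+ n) c≡r) r+n≡a+d)
    where
    r = a + d ∸ n
    r+n≡a+d : r + n ≡ a + d
    r+n≡a+d = m∸n+n≡m (≮⇒≥ a+d≮n)
    r<n : r < n
    r<n = +-cancelʳ-< n r n (≤-trans (s≤s (≤-reflexive r+n≡a+d)) (+-mono-≤ a<n d≤n))
    c≡r : c ≡ r
    c≡r = trans c≡ (trans (cong (_% n) (sym r+n≡a+d)) (trans ([m+n]%n≡m%n r n) (m<n⇒m%n≡m r<n)))

  Φ-close : ∀ (f : ℕ → ℕ) d {lo} → (∀ m → Close (f m) (f (d + m))) → (∀ {a b} → a ≤ b → f a ≤ f b) →
            (∀ m → lo ≤ f m) → f d ≤ suc lo → d ≤ n →
            ∀ {a c} → a < n → c ≡ (a + d) % n → Close (Φ f a) (Φ f c)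
  Φ-close f d step mono lo≤f fd≤ d≤n {a} {c} a<n c≡ with [a+d]%n-cases d a<n d≤n c≡
  ... | inj₁ refl =
    Close-⊓ (step a) (Close-sym (subst (λ x → Close (f (n ∸ (d + a))) (f x))
                                       (sym (n∸a≡d+[n∸[d+a]] d d+a≤n)) (step _)))
    where
    d+a≤n : d + a ≤ n
    d+a≤n = <⇒≤ (subst (_< n) (sym c≡) (m%n<n (a + d) n))
  -- Across the wrap-around both values lie between lo and f d, as c < d and n ∸ a ≤ d.
  ... | inj₂ c+n≡a+d =
    Close-within (⊓-glb (lo≤f a) (lo≤f _)) (≤-trans (m⊓n≤n _ _) (≤-trans (mono n∸a≤d) fd≤))
                 (⊓-glb (lo≤f c) (lo≤f _)) (≤-trans (m⊓n≤m _ _) (≤-trans (mono (<⇒≤ c<d)) fd≤))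
    where
    c<d : c < d
    c<d = +-cancelʳ-< n c d (subst (_< d + n) (sym c+n≡a+d) (subst (a + d <_) (+-comm n d) (+-monoˡ-< d a<n)))
    n∸a≤d : n ∸ a ≤ d
    n∸a≤d = m≤n+o⇒m∸n≤o n a (subst (n ≤_) c+n≡a+d (m≤n+m n c))

module GP₂ (n-2 : ℕ) where

  n : ℕ
  n = 2+ n-2

  open Reflection n
  open Walks n 2

  u₀ v₀ : Vertex n
  u₀ = inj₁ zero
  v₀ = inj₂ zero

  ≡ₙ-sound : ∀ {j : Fin n} {m} → (j ≡ₙ m) ≡ true → toℕ j ≡ m % n
  ≡ₙ-sound {j} {m} = ⌊⌋-true⁻ (toℕ j ≟ m % n)

  ≡ₙ-complete : ∀ {j : Fin n} {m} → toℕ j ≡ m % n → (j ≡ₙ m) ≡ true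
  ≡ₙ-complete {j} {m} = ⌊⌋-true⁺ (toℕ j ≟ m % n)

  φ : Vertex n → ℕ
  φ (inj₁ i) = Φ hu (toℕ i)
  φ (inj₂ i) = Φ hv (toℕ i)

  outer-close : ∀ {i j : Fin n} → (j ≡ₙ (toℕ i + 1)) ≡ true → Close (φ (inj₁ i)) (φ (inj₁ j))
  outer-close {i} {j} e =
    Φ-close hu 1 hu-step hu-mono (λ _ → z≤n) ≤-refl (s≤s z≤n) (toℕ<n i) (≡ₙ-sound {j} {toℕ i + 1} e)

  inner-close : ∀ {i j : Fin n} → (j ≡ₙ (toℕ i + 2)) ≡ true → Close (φ (inj₂ i)) (φ (inj₂ j))
  inner-close {i} {j} e =
    Φ-close hv 2 hv-step hv-mono (λ _ → s≤s z≤n) ≤-refl (s≤s (s≤s z≤n)) (toℕ<n i) (≡ₙ-sound {j} {toℕ i + 2} e)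

  φ-close : ∀ {x z} → Edge x z → Close (φ x) (φ z)
  φ-close {inj₁ i} {inj₁ j} (edge e) with ∨-true⁻ {j ≡ₙ (toℕ i + 1)} e
  ... | inj₁ i→j = outer-close i→j
  ... | inj₂ j→i = Close-sym (outer-close j→i)
  φ-close {inj₂ i} {inj₂ j} (edge e) with ∨-true⁻ {j ≡ₙ (toℕ i + 2)} e
  ... | inj₁ i→j = inner-close i→j
  ... | inj₂ j→i = Close-sym (inner-close j→i)
  φ-close {inj₁ i} {inj₂ j} (edge e) with refl ← ⌊⌋-true⁻ (i ≟ᶠ j) e = Close-⊓ (hu-hv _) (hu-hv _)
  φ-close {inj₂ i} {inj₁ j} (edge e) with refl ← ⌊⌋-true⁻ (i ≟ᶠ j) e = Close-sym (Close-⊓ (hu-hv _) (hu-hv _))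

  φ≤2n : ∀ w → φ w ≤ 2 * n
  φ≤2n (inj₁ i) = ≤-trans (m⊓n≤m _ _) (≤-trans (m⊓n≤m _ _) (≤-trans (<⇒≤ (toℕ<n i)) (m≤m+n n _)))
  φ≤2n (inj₂ i) = ≤-trans (m⊓n≤m _ _) (≤-trans (s≤s (⌈n/2⌉≤n _)) (≤-trans (toℕ<n i) (m≤m+n n _)))

  φ≤dist-u₀ : ∀ w → φ w ≤ dist n 2 u₀ w
  φ≤dist-u₀ = potential≤dist φ (proj₂ ∘ φ-close) φ≤2n {u₀} refl

  outer inner : ℕ → Vertex n
  outer a = inj₁ (a mod n)
  inner a = inj₂ (a mod n)

  toℕ-mod : ∀ a → toℕ (a mod n) ≡ a % n
  toℕ-mod a = toℕ-fromℕ< (m%n<n a n)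

  [m%n+d]%n≡[d+m]%n : ∀ m d → (m % n + d) % n ≡ (d + m) % n
  [m%n+d]%n≡[d+m]%n m d = begin
    (m % n + d) % n            ≡⟨ %-distribˡ-+ (m % n) d n ⟩
    (m % n % n + d % n) % n    ≡⟨ cong (λ x → (x + d % n) % n) (m%n%n≡m%n m n) ⟩
    (m % n + d % n) % n        ≡⟨ %-distribˡ-+ m d n ⟨
    (m + d) % n                ≡⟨ cong (_% n) (+-comm m d) ⟩
    (d + m) % n                ∎
    where open ≡-Reasoning

  ≡ₙ-shift : ∀ a d → (((d + a) mod n) ≡ₙ (toℕ (a mod n) + d)) ≡ true
  ≡ₙ-shift a d = ≡ₙ-complete {(d + a) mod n} {toℕ (a mod n) + d} (begin
    toℕ ((d + a) mod n)        ≡⟨ toℕ-mod (d + a) ⟩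
    (d + a) % n                ≡⟨ [m%n+d]%n≡[d+m]%n a d ⟨
    (a % n + d) % n            ≡⟨ cong (λ x → (x + d) % n) (toℕ-mod a) ⟨
    (toℕ (a mod n) + d) % n    ∎)
    where open ≡-Reasoning

  outer-edge : ∀ a → Edge (outer a) (outer (1 + a))
  outer-edge a = edge (∨-introˡ (≡ₙ-shift a 1))

  outer-edge⁻ : ∀ a → Edge (outer (1 + a)) (outer a)
  outer-edge⁻ a = edge (∨-introʳ (≡ₙ-shift a 1))

  inner-edge : ∀ a → Edge (inner a) (inner (2 + a))
  inner-edge a = edge (∨-introˡ (≡ₙ-shift a 2))

  inner-edge⁻ : ∀ a → Edge (inner (2 + a)) (inner a)
  inner-edge⁻ a = edge (∨-introʳ (≡ₙ-shift a 2))

  spoke-edge : ∀ a → Edge (inner a) (outer a)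
  spoke-edge a = edge (⌊⌋-true⁺ (a mod n ≟ᶠ a mod n) refl)

  inner-outer-path : ∀ b a → Path (hv b) (inner a) (outer (b + a))
  inner-outer-path zero          a = spoke-edge a ∷ []
  inner-outer-path (suc zero)    a = spoke-edge a ∷ outer-edge a ∷ []
  inner-outer-path (suc (suc b)) a =
    inner-edge a ∷ subst (Path (hv b) (inner (2 + a)) ∘ outer) b+[2+a]≡2+b+a (inner-outer-path b (2 + a))
    where
    b+[2+a]≡2+b+a : b + (2 + a) ≡ 2 + b + a
    b+[2+a]≡2+b+a = trans (+-suc b (suc a)) (cong suc (+-suc b a))

  inner-outer-path⁻ : ∀ c a → Path (hv c) (inner (c + a)) (outer a)
  inner-outer-path⁻ zero          a = spoke-edge a ∷ []
  inner-outer-path⁻ (suc zero)    a = spoke-edge (1 + a) ∷ outer-edge⁻ a ∷ []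
  inner-outer-path⁻ (suc (suc c)) a = inner-edge⁻ (c + a) ∷ inner-outer-path⁻ c a

  inner-path : ∀ q a → Path q (inner a) (inner (q + q + a))
  inner-path zero    a = []
  inner-path (suc q) a =
    inner-edge a ∷ subst (Path q (inner (2 + a)) ∘ inner) q+q+[2+a]≡ (inner-path q (2 + a))
    where
    q+q+[2+a]≡ : q + q + (2 + a) ≡ suc q + suc q + a
    q+q+[2+a]≡ = begin
      q + q + (2 + a)      ≡⟨ +-suc (q + q) (suc a) ⟩
      suc (q + q + suc a)  ≡⟨ cong suc (+-suc (q + q) a) ⟩
      2 + (q + q) + a      ≡⟨ cong (λ x → suc x + a) (+-suc q q) ⟨
      suc q + suc q + a    ∎
      where open ≡-Reasoning

  inner-path⁻ : ∀ q a → Path q (inner (q + q + a)) (inner a)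
  inner-path⁻ zero    a = []
  inner-path⁻ (suc q) a =
    subst (λ x → Path (suc q) (inner (x + a)) (inner a)) (cong suc (sym (+-suc q q)))
          (inner-edge⁻ (q + q + a) ∷ inner-path⁻ q a)

  outer-toℕ : (i : Fin n) → outer (toℕ i) ≡ inj₁ i
  outer-toℕ i = cong inj₁ (toℕ-injective (trans (toℕ-mod (toℕ i)) (m<n⇒m%n≡m (toℕ<n i))))

  inner-toℕ : (i : Fin n) → inner (toℕ i) ≡ inj₂ i
  inner-toℕ i = cong inj₂ (toℕ-injective (trans (toℕ-mod (toℕ i)) (m<n⇒m%n≡m (toℕ<n i))))

  inner-n : inner n ≡ v₀
  inner-n = cong inj₂ (toℕ-injective (trans (toℕ-mod n) (n%n≡0 n)))

  ≤n⇒<2n : ∀ {ℓ} → ℓ ≤ n → ℓ < 2 * n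
  ≤n⇒<2n ℓ≤n = ≤-<-trans ℓ≤n (m<m+n n (s≤s z≤n))

  hv<2n : ∀ {c} → c ≤ n → hv c < 2 * n
  hv<2n c≤n = ≤n⇒<2n (≤-trans (hv-mono c≤n) (s≤s (s≤s (⌈n/2⌉≤n n-2))))

  dist-v₀-outer : (i : Fin n) → dist n 2 v₀ (inj₁ i) ≤ Φ hv (toℕ i)
  dist-v₀-outer i = ⊓-glb (dist-≤ forward (hv<2n (<⇒≤ (toℕ<n i)))) (dist-≤ backward (hv<2n (m∸n≤m n b)))
    where
    b = toℕ i
    forward : Path (hv b) v₀ (inj₁ i)
    forward = subst (Path (hv b) v₀) (trans (cong outer (+-identityʳ b)) (outer-toℕ i)) (inner-outer-path b 0)
    backward : Path (hv (n ∸ b)) v₀ (inj₁ i)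
    backward = subst₂ (Path (hv (n ∸ b))) (trans (cong inner (m∸n+n≡m (<⇒≤ (toℕ<n i)))) inner-n)
                      (outer-toℕ i) (inner-outer-path⁻ (n ∸ b) b)

  dist-v₀-inner : (i : Fin n) → ∀ q → q + q ≡ toℕ i ⊎ q + q + toℕ i ≡ n → dist n 2 v₀ (inj₂ i) ≤ q
  dist-v₀-inner i q (inj₁ q+q≡b) =
    dist-≤ (subst (Path q v₀) (trans (cong inner (trans (+-identityʳ (q + q)) q+q≡b)) (inner-toℕ i))
                  (inner-path q 0))
           (≤n⇒<2n (≤-trans (m≤m+n q q) (≤-trans (≤-reflexive q+q≡b) (<⇒≤ (toℕ<n i)))))
  dist-v₀-inner i q (inj₂ q+q+b≡n) =
    dist-≤ (subst₂ (Path q) (trans (cong inner q+q+b≡n) inner-n) (inner-toℕ i) (inner-path⁻ q (toℕ i)))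
           (≤n⇒<2n (≤-trans (m≤m+n q q) (≤-trans (m≤m+n (q + q) (toℕ i)) (≤-reflexive q+q+b≡n))))

  v₀-closer-to-outer : (i : Fin n) → 4 ≤ toℕ i → 4 ≤ n ∸ toℕ i →
                       dist n 2 v₀ (inj₁ i) < dist n 2 u₀ (inj₁ i)
  v₀-closer-to-outer i 4≤b 4≤n∸b =
    ≤-<-trans (dist-v₀-outer i) (<-≤-trans (⊓-mono-< (hv<hu 4≤b) (hv<hu 4≤n∸b)) (φ≤dist-u₀ (inj₁ i)))

  v₀-closer-to-inner : (i : Fin n) → ∀ q → q + q ≡ toℕ i ⊎ q + q + toℕ i ≡ n →
                       q + q ≤ suc (toℕ i) → q + q ≤ suc (n ∸ toℕ i) →
                       dist n 2 v₀ (inj₂ i) < dist n 2 u₀ (inj₂ i)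
  v₀-closer-to-inner i q reach q+q≤ q+q≤′ =
    ≤-<-trans (dist-v₀-inner i q reach) (<-≤-trans (⊓-glb (<hv q+q≤) (<hv q+q≤′)) (φ≤dist-u₀ (inj₂ i)))

evenAtMost : ℕ → ℕ → Bool
evenAtMost c m = (m ≤ᵇ c) ∧ (m ≡ᵇ ⌊ m /2⌋ + ⌊ m /2⌋)

evenAtMost-sound : ∀ {c m} → T (evenAtMost c m) → m ≤ c × ⌊ m /2⌋ + ⌊ m /2⌋ ≡ m
evenAtMost-sound {c} {m} t with Equivalence.to T-∧ t
... | m≤c , even = ≤ᵇ⇒≤ m c m≤c , sym (≡ᵇ⇒≡ m _ even)

pattern 16+ k = 2+ (2+ (2+ (2+ (2+ (2+ (2+ (2+ k)))))))
pattern 18+ k = 2+ (16+ k)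

module AtLeast18 (k : ℕ) where

  open GP₂ (16+ k)

  outerNear innerNear : ℕ → Bool
  outerNear b = (4 ≤ᵇ b) ∧ (4 ≤ᵇ n ∸ b)
  innerNear b = evenAtMost 6 b ∨ evenAtMost 8 (n ∸ b)

  nearSpoke : Vertex n → Bool
  nearSpoke (inj₁ i) = outerNear (toℕ i)
  nearSpoke (inj₂ i) = innerNear (toℕ i)

  outerNear-sound : ∀ {b} → T (outerNear b) → 4 ≤ b × 4 ≤ n ∸ b
  outerNear-sound {b} t with Equivalence.to T-∧ t
  ... | 4≤b , 4≤n∸b = ≤ᵇ⇒≤ 4 b 4≤b , ≤ᵇ⇒≤ 4 (n ∸ b) 4≤n∸b

  innerNear-sound : ∀ {b} → b < n → T (innerNear b) →
                    ∃[ q ] (q + q ≡ b ⊎ q + q + b ≡ n) × q + q ≤ suc b × q + q ≤ suc (n ∸ b)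
  innerNear-sound {b} b<n t with Equivalence.to T-∨ t
  ... | inj₁ t′ with evenAtMost-sound t′
  ...   | b≤6 , q+q≡b =
    ⌊ b /2⌋ , inj₁ q+q≡b , ≤-trans (≤-reflexive q+q≡b) (n≤1+n b) ,
    ≤-trans (≤-reflexive q+q≡b) (≤-trans b≤6 
      (≤-trans (m≤m+n 6 (6 + k)) (≤-trans (∸-monoʳ-≤ n b≤6) (n≤1+n _))))
  innerNear-sound {b} b<n t | inj₂ t′ with evenAtMost-sound t′
  ...   | c≤8 , q+q≡c =
    ⌊ n ∸ b /2⌋ , inj₂ (trans (cong (_+ b) q+q≡c) c+b≡n) ,
    ≤-trans (≤-reflexive q+q≡c) (≤-trans c≤8 (≤-trans (m≤m+n 8 (2 + k)) (≤-trans 10+k≤b (n≤1+n b)))) ,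
    ≤-trans (≤-reflexive q+q≡c) (n≤1+n _)
    where
    c+b≡n : n ∸ b + b ≡ n
    c+b≡n = m∸n+n≡m (<⇒≤ b<n)
    10+k≤b : 10 + k ≤ b
    10+k≤b = +-cancelˡ-≤ 8 _ _ (subst (_≤ 8 + b) c+b≡n (+-monoˡ-≤ b c≤8))

  -- No with-abstraction here: it would normalise the goal's dist n 2, which is very slow.
  nearSpoke-closer : ∀ w → T (nearSpoke w) → dist n 2 v₀ w < dist n 2 u₀ w
  nearSpoke-closer (inj₁ i) t = uncurry (v₀-closer-to-outer i) (outerNear-sound t)
  nearSpoke-closer (inj₂ i) t = closer (innerNear-sound (toℕ<n i) t)
    where
    closer : ∃[ q ] (q + q ≡ toℕ i ⊎ q + q + toℕ i ≡ n) × q + q ≤ suc (toℕ i) × q + q ≤ suc (n ∸ toℕ i) →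
             dist n 2 v₀ (inj₂ i) < dist n 2 u₀ (inj₂ i)
    closer (q , reach , ≤b , ≤n∸b) = v₀-closer-to-inner i q reach ≤b ≤n∸b

  count-outerNear : 11 + k ≤ count outerNear n
  count-outerNear = begin
    11 + k                                       ≡⟨ count-all (11 + k) near ⟨
    count (λ j → outerNear (4 + j)) (11 + k)     ≤⟨ count-≤ˡ (λ j → outerNear (4 + j)) (11 + k) 3 ⟩
    count (λ j → outerNear (4 + j)) (11 + k + 3) ≤⟨ count-≤ʳ outerNear 4 (11 + k + 3) ⟩
    count outerNear (4 + (11 + k + 3))           ≡⟨ cong (λ x → count outerNear (15 + x)) (+-comm k 3) ⟩
    count outerNear n                            ∎
    where
    open ≤-Reasoning
    near : ∀ j → j < 11 + k → T (outerNear (4 + j))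
    near j j<11+k =
      Equivalence.from T-∧ (≤⇒≤ᵇ (m≤m+n 4 j) , ≤⇒≤ᵇ (m+n≤o⇒m≤o∸n 4 (+-monoʳ-≤ 3 j<11+k)))

  count-innerNear : 8 ≤ count innerNear n
  count-innerNear = begin
    8
      ≡⟨⟩
    count innerNear 10 + count (λ j → evenAtMost 8 (8 ∸ j)) 8
      ≤⟨ +-monoʳ-≤ (count innerNear 10) (count-mono 8 near) ⟩
    count innerNear 10 + count (λ j → innerNear (10 + (k + j))) 8
      ≤⟨ +-monoʳ-≤ (count innerNear 10) (count-≤ʳ (λ j → innerNear (10 + j)) k 8) ⟩
    count innerNear 10 + count (λ j → innerNear (10 + j)) (k + 8)
      ≡⟨ count-+ innerNear 10 (k + 8) ⟨
    count innerNear (10 + (k + 8))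
      ≡⟨ cong (λ x → count innerNear (10 + x)) (+-comm k 8) ⟩
    count innerNear n
      ∎
    where
    open ≤-Reasoning
    near : ∀ j → j < 8 → T (evenAtMost 8 (8 ∸ j)) → T (innerNear (10 + (k + j)))
    near j _ t = Equivalence.from T-∨ (inj₂ (subst (T ∘ evenAtMost 8) (sym n∸[10+k+j]≡8∸j) t))
      where
      n∸[10+k+j]≡8∸j : n ∸ (10 + (k + j)) ≡ 8 ∸ j
      n∸[10+k+j]≡8∸j = trans (cong (_∸ (k + j)) (+-comm 8 k)) ([m+n]∸[m+o]≡n∸o k 8 j)

  count-nearSpoke : length (filter (T? ∘ nearSpoke) (vertices n)) ≡ count outerNear n + count innerNear n
  count-nearSpoke = begin
    length (filter near? (map inj₁ (allFin n) ++ map inj₂ (allFin n)))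
      ≡⟨ cong length (filter-++ near? (map inj₁ (allFin n)) _) ⟩
    length (filter near? (map inj₁ (allFin n)) ++ filter near? (map inj₂ (allFin n)))
      ≡⟨ length-++ (filter near? (map inj₁ (allFin n))) ⟩
    length (filter near? (map inj₁ (allFin n))) + length (filter near? (map inj₂ (allFin n)))
      ≡⟨ cong₂ _+_ (counted inj₁ outerNear (λ _ → refl)) (counted inj₂ innerNear (λ _ → refl)) ⟩
    count outerNear n + count innerNear n
      ∎
    where
    open ≡-Reasoning
    near? = T? ∘ nearSpoke
    counted : ∀ (g : Fin n → Vertex n) p → (∀ i → nearSpoke (g i) ≡ p (toℕ i)) →
              length (filter near? (map g (allFin n))) ≡ count p n
    counted g p agree = trans (cong (length ∘ filter near?) (map-tabulate id g)) (length-filter-tabulate near? g p agree)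

  spoke-unbalanced : length (W n 2 u₀ v₀) ≢ length (W n 2 v₀ u₀)
  spoke-unbalanced eq = <-irrefl refl (begin-strict
    n + n                             <⟨ +-mono-< n<|W₀| n<|W₀| ⟩
    length W₀ + length W₀             ≡⟨ cong (_+ length W₀) eq ⟨
    length (W n 2 u₀ v₀) + length W₀  ≤⟨ length-filter-disjoint (closer? u₀ v₀) (closer? v₀ u₀) <-asym (vertices n) ⟩
    length (vertices n)               ≡⟨ length-vertices n ⟩
    n + n                             ∎)
    where
    open ≤-Reasoning
    W₀ = W n 2 v₀ u₀
    near? = T? ∘ nearSpoke
    closer? : ∀ x y w → Dec (dist n 2 x w < dist n 2 y w)
    closer? x y w = dist n 2 x w <? dist n 2 y w
    n<|W₀| : n < length W₀
    n<|W₀| = begin-strict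
      n                                                  <⟨ n<1+n n ⟩
      11 + (8 + k)                                       ≡⟨ cong (11 +_) (+-comm 8 k) ⟩
      11 + k + 8                                         ≤⟨ +-mono-≤ count-outerNear count-innerNear ⟩
      count outerNear n + count innerNear n              ≡⟨ count-nearSpoke ⟨
      length (filter near? (vertices n))                 ≤⟨ length-filter-mono near? (closer? v₀ u₀) (λ {w} → nearSpoke-closer w) (vertices n) ⟩
      length W₀                                          ∎

unbalanced-edge : ∀ n (x y : Vertex n) a b → adj n 2 x y ≡ true →
                  length (W n 2 x y) ≡ a → length (W n 2 y x) ≡ b → a ≢ b → ¬ OneDistanceBalanced n 2
unbalanced-edge n x y a b xy |Wxy|≡a |Wyx|≡b a≢b (_ , balanced) =
  a≢b (trans (sym |Wxy|≡a) (trans (balanced x y xy) |Wyx|≡b))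

connected? balanced? : ℕ → Bool
connected? n = all (λ x → all (walk n 2 (2 * n) x) (vertices n)) (vertices n)
balanced? n = all (λ x → all (λ y → not (adj n 2 x y) ∨ ⌊ length (W n 2 x y) ≟ length (W n 2 y x) ⌋)
                             (vertices n))
                  (vertices n)

oneDistanceBalanced-by-evaluation : ∀ n → connected? n ≡ true → balanced? n ≡ true → OneDistanceBalanced n 2
oneDistanceBalanced-by-evaluation n connected balanced = connected-xy , balanced-xy
  where
  connected-xy : Connected n 2
  connected-xy x y = all-true⁻ _ (all-true⁻ _ connected (∈-vertices x)) (∈-vertices y)
  balanced-xy : ∀ x y → adj n 2 x y ≡ true → length (W n 2 x y) ≡ length (W n 2 y x)
  balanced-xy x y xy = ⌊⌋-true⁻ (_ ≟ _)
    (subst (λ a → not a ∨ ⌊ length (W n 2 x y) ≟ length (W n 2 y x) ⌋ ≡ true) xy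
           (all-true⁻ _ (all-true⁻ _ balanced (∈-vertices x)) (∈-vertices y)))

-- The as-patterns keep n syntactically equal to the index in the goal; a fresh literal would
-- make Agda unfold OneDistanceBalanced when comparing the two.
exceptional-if-balanced : ∀ n → 5 ≤ n → OneDistanceBalanced n 2 → n ≡ 5 ⊎ n ≡ 7 ⊎ n ≡ 10
exceptional-if-balanced 5  _ _ = inj₁ refl
exceptional-if-balanced 7  _ _ = inj₂ (inj₁ refl)
exceptional-if-balanced 10 _ _ = inj₂ (inj₂ refl)
exceptional-if-balanced n@6  _ = ⊥-elim ∘ unbalanced-edge n (inj₁ zero) (inj₂ zero) 6 3 refl refl refl λ ()
exceptional-if-balanced n@8  _ = ⊥-elim ∘ unbalanced-edge n (inj₁ zero) (inj₂ zero) 7 5 refl refl refl λ ()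
exceptional-if-balanced n@9  _ = ⊥-elim ∘ unbalanced-edge n (inj₁ zero) (inj₂ zero) 5 7 refl refl refl λ ()
exceptional-if-balanced n@11 _ = ⊥-elim ∘ unbalanced-edge n (inj₁ zero) (inj₂ zero) 7 11 refl refl refl λ ()
exceptional-if-balanced n@12 _ = ⊥-elim ∘ unbalanced-edge n (inj₁ zero) (inj₂ zero) 9 11 refl refl refl λ ()
exceptional-if-balanced n@13 _ = ⊥-elim ∘ unbalanced-edge n (inj₁ zero) (inj₂ zero) 7 13 refl refl refl λ ()
exceptional-if-balanced n@14 _ = ⊥-elim ∘ unbalanced-edge n (inj₁ zero) (inj₂ zero) 10 14 refl refl refl λ ()
exceptional-if-balanced n@15 _ = ⊥-elim ∘ unbalanced-edge n (inj₁ zero) (inj₂ zero) 9 17 refl refl refl λ ()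
exceptional-if-balanced n@16 _ = ⊥-elim ∘ unbalanced-edge n (inj₁ zero) (inj₂ zero) 11 17 refl refl refl λ ()
exceptional-if-balanced n@17 _ = ⊥-elim ∘ unbalanced-edge n (inj₁ zero) (inj₂ zero) 9 19 refl refl refl λ ()
exceptional-if-balanced (18+ k) _ (_ , balanced) =
  ⊥-elim (AtLeast18.spoke-unbalanced k (balanced (inj₁ zero) (inj₂ zero) refl))
exceptional-if-balanced 0 ()
exceptional-if-balanced 1 (s≤s ())
exceptional-if-balanced 2 (s≤s (s≤s ()))
exceptional-if-balanced 3 (s≤s (s≤s (s≤s ())))
exceptional-if-balanced 4 (s≤s (s≤s (s≤s (s≤s ()))))

balanced-if-exceptional : ∀ {n} → n ≡ 5 ⊎ n ≡ 7 ⊎ n ≡ 10 → OneDistanceBalanced n 2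
balanced-if-exceptional (inj₁ refl)        = oneDistanceBalanced-by-evaluation 5 refl refl
balanced-if-exceptional (inj₂ (inj₁ refl)) = oneDistanceBalanced-by-evaluation 7 refl refl
balanced-if-exceptional (inj₂ (inj₂ refl)) = oneDistanceBalanced-by-evaluation 10 refl refl

proposition4p5 : (n : ℕ) → 5 ≤ n →
    (OneDistanceBalanced n 2 ⇔ (n ≡ 5 ⊎ n ≡ 7 ⊎ n ≡ 10))
proposition4p5 n 5≤n = mk⇔ (exceptional-if-balanced n 5≤n) balanced-if-exceptional
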